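{- Let $p$ be a prime with $p \equiv 7$ or $23 \pmod{40}$. Then there is no triple $(N,M,e) \in \mathbb{Z}^3$ with $M \neq 0$, $e \neq 0$ satisfying $N^2 = 4M^4 + 5pe^4$ together with $\gcd(N,e)=\gcd(M,e)=\gcd(4,e)=\gcd(5p,M)=\gcd(M,N)=1$. -}

module Defs where

-- Reduce modulo 4: since p ≡ 3 (mod 4) we have 5p ≡ 3, and gcd(4, e) = 1 makes e odd, so
-- e⁴ ≡ 1 and N² ≡ 4M⁴ + 5pe⁴ ≡ 3 (mod 4), which no square is.  Only the conditions
-- p ≡ 3 (mod 4) and gcd(4, e) = 1 are used.
module Submission where

open import Defs
open import Data.Nat using (ℕ)
open import Data.Nat.DivMod using (_%_)
open import Data.Nat.Primality using (Prime)
open import Data.Integer using (ℤ; +_; _+_; _*_; _^_)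
open import Data.Integer.GCD using (gcd)
open import Data.Product using (_×_; ∃-syntax)
open import Data.Sum using (_⊎_)
open import Relation.Nullary using (¬_)
open import Relation.Binary.PropositionalEquality using (_≡_; _≢_)

open import Data.Nat as ℕ using (zero; suc; NonZero; s≤s)
open import Data.Nat.DivMod using (%-distribˡ-*; %-remove-+ˡ; m%n%n≡m%n; m%n<n; m∣n⇒o%n%m≡o%m)
open import Data.Nat.Divisibility using (divides; m∣m*n; m%n≡0⇒n∣m)
open import Data.Nat.Coprimality using (gcd≡1⇒coprime)
import Data.Nat.GCD as ℕ
import Data.Integer as ℤ
open import Data.Integer.Properties using (pos-+; pos-*; +-injective)
open import Data.Product using (_,_)
open import Data.Sum using (inj₁; inj₂)
open import Relation.Nullary using (contradiction)
open import Relation.Binary.PropositionalEquality using (refl; sym; trans; cong; cong₂; module ≡-Reasoning)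

open ≡-Reasoning

^-cong-% : ∀ {m n} k d .{{_ : NonZero d}} → m % d ≡ n % d → m ℕ.^ k % d ≡ n ℕ.^ k % d
^-cong-% zero d _ = refl
^-cong-% {m} {n} (suc k) d m≡n = begin
  m ℕ.* m ℕ.^ k % d                 ≡⟨ %-distribˡ-* m (m ℕ.^ k) d ⟩
  (m % d) ℕ.* (m ℕ.^ k % d) % d     ≡⟨ cong₂ (λ a b → a ℕ.* b % d) m≡n (^-cong-% k d m≡n) ⟩
  (n % d) ℕ.* (n ℕ.^ k % d) % d     ≡⟨ %-distribˡ-* n (n ℕ.^ k) d ⟨
  n ℕ.* n ℕ.^ k % d                 ∎

^-%4 : ∀ n k → n ℕ.^ k % 4 ≡ (n % 4) ℕ.^ k % 4
^-%4 n k = ^-cong-% k 4 (sym (m%n%n≡m%n n 4))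

n^2%4≢3 : ∀ n → n ℕ.^ 2 % 4 ≢ 3
n^2%4≢3 n rewrite ^-%4 n 2 with n % 4 | m%n<n n 4
... | 0 | _ = λ ()
... | 1 | _ = λ ()
... | 2 | _ = λ ()
... | 3 | _ = λ ()
... | suc (suc (suc (suc _))) | s≤s (s≤s (s≤s (s≤s ())))

odd⇒n^4%4≡1 : ∀ n → n % 2 ≡ 1 → n ℕ.^ 4 % 4 ≡ 1
odd⇒n^4%4≡1 n odd rewrite ^-%4 n 4
  with n % 4 | m%n<n n 4 | trans (m∣n⇒o%n%m≡o%m 2 4 n (divides 2 refl)) odd
... | 1 | _ | _ = refl
... | 3 | _ | _ = refl
... | 0 | _ | ()
... | 2 | _ | ()
... | suc (suc (suc (suc _))) | s≤s (s≤s (s≤s (s≤s ()))) | _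

coprime-4⇒odd : ∀ c → ℕ.gcd 4 c ≡ 1 → c % 2 ≡ 1
coprime-4⇒odd c gcd≡1 with c % 2 in c%2≡0 | m%n<n c 2
... | 0 | _ = contradiction (gcd≡1⇒coprime gcd≡1 (divides 2 refl , m%n≡0⇒n∣m c 2 c%2≡0)) λ ()
... | 1 | _ = refl
... | suc (suc _) | s≤s (s≤s ())

%40≡7∨23⇒%4≡3 : ∀ p → p % 40 ≡ 7 ⊎ p % 40 ≡ 23 → p % 4 ≡ 3
%40≡7∨23⇒%4≡3 p p%40 = trans (sym (m∣n⇒o%n%m≡o%m 4 40 p (divides 10 refl))) (residue p%40)
  where
  residue : p % 40 ≡ 7 ⊎ p % 40 ≡ 23 → p % 40 % 4 ≡ 3
  residue (inj₁ p%40≡7)  = cong (_% 4) p%40≡7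
  residue (inj₂ p%40≡23) = cong (_% 4) p%40≡23

5*p%4≡3 : ∀ p → p % 4 ≡ 3 → 5 ℕ.* p % 4 ≡ 3
5*p%4≡3 p p%4≡3 = trans (%-distribˡ-* 5 p 4) (cong (λ r → (1 ℕ.* r) % 4) p%4≡3)

n^2≢4m^4+qc^4 : ∀ n m q c → q % 4 ≡ 3 → c % 2 ≡ 1 →
                n ℕ.^ 2 ≢ 4 ℕ.* m ℕ.^ 4 ℕ.+ q ℕ.* c ℕ.^ 4
n^2≢4m^4+qc^4 n m q c q%4≡3 odd eq = n^2%4≢3 n (begin
  n ℕ.^ 2 % 4                                ≡⟨ cong (_% 4) eq ⟩
  (4 ℕ.* m ℕ.^ 4 ℕ.+ q ℕ.* c ℕ.^ 4) % 4      ≡⟨ %-remove-+ˡ (q ℕ.* c ℕ.^ 4) (m∣m*n (m ℕ.^ 4)) ⟩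
  q ℕ.* c ℕ.^ 4 % 4                          ≡⟨ %-distribˡ-* q (c ℕ.^ 4) 4 ⟩
  (q % 4) ℕ.* (c ℕ.^ 4 % 4) % 4              ≡⟨ cong₂ (λ a b → a ℕ.* b % 4) q%4≡3 (odd⇒n^4%4≡1 c odd) ⟩
  3                                          ∎)

i^2≡+∣i∣^2 : ∀ i → i ^ 2 ≡ + (ℤ.∣ i ∣ ℕ.^ 2)
i^2≡+∣i∣^2 (+ zero)   = refl
i^2≡+∣i∣^2 (+ suc n)  = refl
i^2≡+∣i∣^2 ℤ.-[1+ n ] = refl

i^4≡+∣i∣^4 : ∀ i → i ^ 4 ≡ + (ℤ.∣ i ∣ ℕ.^ 4)
i^4≡+∣i∣^4 (+ zero)   = refl
i^4≡+∣i∣^4 (+ suc n)  = refl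
i^4≡+∣i∣^4 ℤ.-[1+ n ] = refl

∣-∣-equation : ∀ q (N M e : ℤ) → N ^ 2 ≡ + 4 * M ^ 4 + + q * e ^ 4 →
               ℤ.∣ N ∣ ℕ.^ 2 ≡ 4 ℕ.* ℤ.∣ M ∣ ℕ.^ 4 ℕ.+ q ℕ.* ℤ.∣ e ∣ ℕ.^ 4
∣-∣-equation q N M e eq = +-injective (begin
  + (ℤ.∣ N ∣ ℕ.^ 2)                  ≡⟨ i^2≡+∣i∣^2 N ⟨
  N ^ 2                              ≡⟨ eq ⟩
  + 4 * M ^ 4 + + q * e ^ 4          ≡⟨ cong₂ (λ a b → + 4 * a + + q * b) (i^4≡+∣i∣^4 M) (i^4≡+∣i∣^4 e) ⟩
  + 4 * + m⁴ + + q * + e⁴            ≡⟨ cong₂ _+_ (pos-* 4 m⁴) (pos-* q e⁴) ⟨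
  + (4 ℕ.* m⁴) + + (q ℕ.* e⁴)        ≡⟨ pos-+ (4 ℕ.* m⁴) (q ℕ.* e⁴) ⟨
  + (4 ℕ.* m⁴ ℕ.+ q ℕ.* e⁴)          ∎)
  where
  m⁴ = ℤ.∣ M ∣ ℕ.^ 4
  e⁴ = ℤ.∣ e ∣ ℕ.^ 4

lemma3p5 : (p : ℕ) → Prime p → (p % 40 ≡ 7 ⊎ p % 40 ≡ 23) →
    ¬ (∃[ N ] ∃[ M ] ∃[ e ]
         (M ≢ + 0 × e ≢ + 0
          × N ^ 2 ≡ + 4 * M ^ 4 + + 5 * + p * e ^ 4
          × gcd N e ≡ + 1 × gcd M e ≡ + 1 × gcd (+ 4) e ≡ + 1
          × gcd (+ 5 * + p) M ≡ + 1 × gcd M N ≡ + 1))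
lemma3p5 p _ p%40 (N , M , e , _ , _ , eq , _ , _ , gcd[4,e]≡1 , _ , _) =
  n^2≢4m^4+qc^4 ℤ.∣ N ∣ ℤ.∣ M ∣ (5 ℕ.* p) ℤ.∣ e ∣
    (5*p%4≡3 p (%40≡7∨23⇒%4≡3 p p%40))
    (coprime-4⇒odd ℤ.∣ e ∣ (+-injective gcd[4,e]≡1))
    (∣-∣-equation (5 ℕ.* p) N M e eq′)
  where
  eq′ : N ^ 2 ≡ + 4 * M ^ 4 + + (5 ℕ.* p) * e ^ 4
  eq′ = trans eq (cong (λ k → + 4 * M ^ 4 + k * e ^ 4) (sym (pos-* 5 p)))
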